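{- Let $T$ be a tournament, $S\subseteq V(T)$, let $\mathcal{C}$ be a conflict $S$-packing of $T$, and let $S_1 = S\setminus V(\mathcal{C})$. Then there exists a vertex ordering $\sigma$ of $T$ such that every $S_1$-backward arc $(u,v)$ of $T_\sigma$ satisfies $(u,v)\in A(\mathcal{C})$.
   Context: A tournament is a directed graph with exactly one arc between every pair of distinct vertices. An $S$-triangle is a directed cycle of length three containing at least one vertex of $S$. A conflict $S$-packing of $T$ is a maximal (with respect to inclusion) collection of pairwise arc-disjoint $S$-triangles; $V(\mathcal{C})$ and $A(\mathcal{C})$ denote the sets of vertices and arcs of the triangles in $\mathcal{C}$. For an ordering $\sigma=v_1,\ldots,v_n$ of $V(T)$ and $X\subseteq V(T)$, an arc $(v_j,v_i)$ with $j>i$ is an $X$-backward arc if either one of $v_i,v_j$ lies in $X$, or there is $q$ with $i<q<j$ and $v_q\in X$. -}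

module Defs where

open import Data.Nat using (ℕ; _<_)
open import Data.Fin using (Fin; toℕ)
open import Data.Product using (Σ; ∃; ∃-syntax; _×_; _,_)
open import Data.Sum using (_⊎_)
open import Data.List using (List)
open import Data.List.Membership.Propositional using (_∈_)
open import Data.List.Relation.Unary.Any using (Any)
open import Relation.Binary.PropositionalEquality using (_≡_; _≢_)
open import Relation.Nullary using (¬_)
open import Data.Empty using (⊥)
open import Function.Bundles using (_↔_)
open import Level using (0ℓ)

record Tournament (n : ℕ) : Set₁ where
  field
    Arc     : Fin n → Fin n → Set
    irrefl  : ∀ u → ¬ Arc u u
    asym    : ∀ u v → Arc u v → ¬ Arc v u
    total   : ∀ u v → u ≢ v → Arc u v ⊎ Arc v u
open Tournament public

VSet : ℕ → Set₁
VSet n = Fin n → Set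

record Triangle {n : ℕ} (T : Tournament n) : Set where
  constructor tri
  field
    a b c : Fin n
    ab : Arc T a b
    bc : Arc T b c
    ca : Arc T c a
open Triangle public

ArcOf : ∀ {n} {T : Tournament n} → Triangle T → Fin n → Fin n → Set
ArcOf t u v = (u ≡ a t × v ≡ b t) ⊎ (u ≡ b t × v ≡ c t) ⊎ (u ≡ c t × v ≡ a t)

VertOf : ∀ {n} {T : Tournament n} → Triangle T → Fin n → Set
VertOf t x = x ≡ a t ⊎ x ≡ b t ⊎ x ≡ c t

IsSTriangle : ∀ {n} {T : Tournament n} → VSet n → Triangle T → Set
IsSTriangle S t = ∃[ x ] (VertOf t x × S x)

ShareArc : ∀ {n} {T : Tournament n} → Triangle T → Triangle T → Set
ShareArc t t' = ∃[ u ] ∃[ v ] (ArcOf t u v × ArcOf t' u v)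

-- A conflict S-packing: a finite collection (list) of S-triangles, indexed
-- by position, pairwise arc-disjoint (distinct positions share no arc), and
-- maximal: every S-triangle shares an arc with some member (so it cannot be
-- added while preserving arc-disjointness).
record ConflictPacking {n : ℕ} (T : Tournament n) (S : VSet n) : Set₁ where
  field
    m        : ℕ
    tri-at   : Fin m → Triangle T
    isS      : ∀ i → IsSTriangle S (tri-at i)
    disjoint : ∀ i j → i ≢ j → ¬ ShareArc (tri-at i) (tri-at j)
    maximal  : ∀ (t : Triangle T) → IsSTriangle S t → ∃[ i ] ShareArc (tri-at i) t
open ConflictPacking public

VC : ∀ {n} {T : Tournament n} {S : VSet n} → ConflictPacking T S → Fin n → Set
VC C x = ∃[ i ] VertOf (tri-at C i) x

AC : ∀ {n} {T : Tournament n} {S : VSet n} → ConflictPacking T S → Fin n → Fin n → Set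
AC C u v = ∃[ i ] ArcOf (tri-at C i) u v

-- A vertex ordering: a bijection from positions to vertices (σ(i) = v_{i+1}).
Ordering : ℕ → Set
Ordering n = Fin n ↔ Fin n

XBackward : ∀ {n} (T : Tournament n) (σ : Ordering n) (X : VSet n) → Fin n → Fin n → Set
XBackward {n} T σ X u v =
  ∃[ i ] ∃[ j ] (u ≡ to j × v ≡ to i × toℕ i < toℕ j × Arc T u v ×
     (X v ⊎ X u ⊎ ∃[ q ] (toℕ i < toℕ q × toℕ q < toℕ j × X (to q))))
  where open Function.Bundles.Inverse σ

-- Call x guarded if x ∉ V(C) and every triangle through x has its opposite arc in A(C);
-- maximality of C makes every vertex of S₁ guarded. The opposite arc puts the other two
-- vertices of such a triangle into V(C), so no triangle has two guarded vertices; hence a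
-- guarded y with y → a → b has y → b as soon as a or b is guarded. Consequently the weight
--   w(v) = #{guarded x : x → v} + #{guarded x : x → v or x = v}
-- strictly increases along every arc with a guarded end, and sorting the vertices by w makes
-- all these arcs forward. A backward arc (u , v) then has no end in S₁, and a vertex q of S₁
-- between its ends satisfies v → q → u, so (u , v) is the arc opposite the guarded q in the
-- triangle q u v.

module Submission where

open import Defs
open import Data.Nat using (ℕ)
open import Data.Product using (∃-syntax; _×_)
open import Relation.Nullary using (¬_)

open import Level using (0ℓ)
open import Data.Nat using (zero; suc; _+_; _≤_; _<_; z≤n; s≤s)
import Data.Nat.Properties as ℕ
open import Data.Fin as Fin using (Fin; toℕ; fromℕ<; punchOut; _≟_)
open import Data.Fin.Properties using (any?; all?; toℕ-fromℕ<; toℕ-injective; punchOut-injective; injective⇒≤)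
open import Data.Product using (_,_; proj₁; proj₂; map₂)
open import Data.Product.Relation.Binary.Lex.Strict using (×-Lex; ×-isStrictTotalOrder)
open import Data.Sum using (_⊎_; inj₁; inj₂; swap)
open import Data.Unit using (tt)
open import Function using (_∘_; _on_; Injection; Inverse; mk↔ₛ′)
open import Function.Definitions using (Injective)
open import Function.Properties.Inverse using (↔⇒↣)
open import Relation.Binary using (Rel; IsStrictTotalOrder; Trichotomous; tri<; tri≈; tri>)
open import Relation.Binary.PropositionalEquality as ≡ using (_≡_; _≢_; refl; sym; cong)
open import Relation.Nullary using (Dec; yes; no; contradiction)
open import Relation.Nullary.Decidable using (_×-dec_; _⊎-dec_; _→-dec_; ¬?)
open import Relation.Unary using (Pred; Decidable; _⊆_)

count : ∀ {n} {P : Pred (Fin n) 0ℓ} → Decidable P → ℕ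
count {zero}  P? = 0
count {suc n} P? with P? Fin.zero
... | yes _ = suc (count (P? ∘ Fin.suc))
... | no  _ = count (P? ∘ Fin.suc)

count-mono : ∀ {n} {P Q : Pred (Fin n) 0ℓ} (P? : Decidable P) (Q? : Decidable Q) →
             P ⊆ Q → count P? ≤ count Q?
count-mono {zero}  P? Q? P⊆Q = z≤n
count-mono {suc n} P? Q? P⊆Q with P? Fin.zero | Q? Fin.zero
... | yes _ | yes _  = s≤s (count-mono (P? ∘ Fin.suc) (Q? ∘ Fin.suc) P⊆Q)
... | yes p | no ¬q  = contradiction (P⊆Q p) ¬q
... | no  _ | yes _  = ℕ.m≤n⇒m≤1+n (count-mono (P? ∘ Fin.suc) (Q? ∘ Fin.suc) P⊆Q)
... | no  _ | no  _  = count-mono (P? ∘ Fin.suc) (Q? ∘ Fin.suc) P⊆Q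

count-strict : ∀ {n} {P Q : Pred (Fin n) 0ℓ} (P? : Decidable P) (Q? : Decidable Q) →
               P ⊆ Q → ∀ {y} → ¬ P y → Q y → count P? < count Q?
count-strict {suc n} P? Q? P⊆Q {Fin.zero} ¬py qy with P? Fin.zero | Q? Fin.zero
... | yes py | _      = contradiction py ¬py
... | no  _  | yes _  = s≤s (count-mono (P? ∘ Fin.suc) (Q? ∘ Fin.suc) P⊆Q)
... | no  _  | no ¬qy = contradiction qy ¬qy
count-strict {suc n} P? Q? P⊆Q {Fin.suc y} ¬py qy with P? Fin.zero | Q? Fin.zero
... | yes _ | yes _  = s≤s (count-strict (P? ∘ Fin.suc) (Q? ∘ Fin.suc) P⊆Q ¬py qy)
... | yes p | no ¬q  = contradiction (P⊆Q p) ¬q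
... | no  _ | yes _  = ℕ.m≤n⇒m≤1+n (count-strict (P? ∘ Fin.suc) (Q? ∘ Fin.suc) P⊆Q ¬py qy)
... | no  _ | no  _  = count-strict (P? ∘ Fin.suc) (Q? ∘ Fin.suc) P⊆Q ¬py qy

count-all : ∀ n → count {n} (λ _ → yes tt) ≡ n
count-all zero    = refl
count-all (suc n) = cong suc (count-all n)

count<n : ∀ {n} {P : Pred (Fin n) 0ℓ} (P? : Decidable P) → ∀ {y} → ¬ P y → count P? < n
count<n {n} P? ¬py = ℕ.<-≤-trans (count-strict P? (λ _ → yes tt) _ ¬py tt) (ℕ.≤-reflexive (count-all n))

injective⇒surjective : ∀ {n} {f : Fin n → Fin n} → Injective _≡_ _≡_ f → ∀ k → ∃[ x ] f x ≡ k
injective⇒surjective {suc n} {f} f-injective k with any? (λ x → f x ≟ k)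
... | yes hit = hit
... | no miss = contradiction (injective⇒≤ punched-injective) ℕ.1+n≰n
  where
  missed : ∀ x → k ≢ f x
  missed x k≡fx = miss (x , sym k≡fx)

  punched-injective : Injective _≡_ _≡_ (λ x → punchOut (missed x))
  punched-injective eq = f-injective (punchOut-injective (missed _) (missed _) eq)

injective-isStrictTotalOrder : ∀ {A B : Set} {_≈_ _<_ : Rel B 0ℓ} (g : A → B) →
  Injective _≡_ _≈_ g → IsStrictTotalOrder _≈_ _<_ → IsStrictTotalOrder _≡_ (_<_ on g)
injective-isStrictTotalOrder {_<_ = _<_} g g-injective sto = record
  { isStrictPartialOrder = record
    { isEquivalence = ≡.isEquivalence
    ; irrefl        = λ { refl → <.irrefl <.Eq.refl }
    ; trans         = <.trans
    ; <-resp-≈      = ≡.resp₂ (_<_ on g)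
    }
  ; compare = compare-on
  }
  where
  module < = IsStrictTotalOrder sto

  compare-on : Trichotomous _≡_ (_<_ on g)
  compare-on x y with <.compare (g x) (g y)
  ... | tri< lt ¬eq ¬gt = tri< lt (λ { refl → ¬eq <.Eq.refl }) ¬gt
  ... | tri≈ ¬lt eq ¬gt = tri≈ ¬lt (g-injective eq) ¬gt
  ... | tri> ¬lt ¬eq gt = tri> ¬lt (λ { refl → ¬eq <.Eq.refl }) gt

module _ {n} {_≺_ : Rel (Fin n) 0ℓ} (sto : IsStrictTotalOrder _≡_ _≺_) where
  open IsStrictTotalOrder sto using (compare; _<?_) renaming (irrefl to ≺-irrefl; trans to ≺-trans)

  rank : Fin n → ℕ
  rank v = count (_<? v)

  rank<n : ∀ v → rank v < n
  rank<n v = count<n (_<? v) (≺-irrefl refl)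

  rank-mono : ∀ {w v} → w ≺ v → rank w < rank v
  rank-mono w≺v = count-strict (_<? _) (_<? _) (λ u≺w → ≺-trans u≺w w≺v) (≺-irrefl refl) w≺v

  rank-injective : Injective _≡_ _≡_ rank
  rank-injective {w} {v} eq with compare w v
  ... | tri< w≺v _ _ = contradiction (rank-mono w≺v) (ℕ.<-irrefl eq)
  ... | tri≈ _ w≡v _ = w≡v
  ... | tri> _ _ v≺w = contradiction (rank-mono v≺w) (ℕ.<-irrefl (sym eq))

  position : Fin n → Fin n
  position v = fromℕ< (rank<n v)

  toℕ-position : ∀ v → toℕ (position v) ≡ rank v
  toℕ-position v = toℕ-fromℕ< (rank<n v)

  position-injective : Injective _≡_ _≡_ position
  position-injective {w} {v} eq =
    rank-injective (≡.trans (sym (toℕ-position w)) (≡.trans (cong toℕ eq) (toℕ-position v)))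

  sortingOrdering : ∃[ σ ] (∀ i j → Inverse.to σ i ≺ Inverse.to σ j → toℕ i < toℕ j)
  sortingOrdering = mk↔ₛ′ vertexAt position vertexAt∘position position∘vertexAt , sorted
    where
    vertexAt : Fin n → Fin n
    vertexAt k = proj₁ (injective⇒surjective position-injective k)

    position∘vertexAt : ∀ k → position (vertexAt k) ≡ k
    position∘vertexAt k = proj₂ (injective⇒surjective position-injective k)

    vertexAt∘position : ∀ v → vertexAt (position v) ≡ v
    vertexAt∘position v = position-injective (position∘vertexAt (position v))

    toℕ≡rank : ∀ i → toℕ i ≡ rank (vertexAt i)
    toℕ≡rank i = ≡.trans (cong toℕ (sym (position∘vertexAt i))) (toℕ-position (vertexAt i))

    sorted : ∀ i j → vertexAt i ≺ vertexAt j → toℕ i < toℕ j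
    sorted i j lt = ≡.subst₂ _<_ (sym (toℕ≡rank i)) (sym (toℕ≡rank j)) (rank-mono lt)

SortedBy : ∀ {n} → (Fin n → ℕ) → Ordering n → Set
SortedBy f σ = ∀ i j → f (to i) < f (to j) → toℕ i < toℕ j
  where open Inverse σ using (to)

sortBy : ∀ {n} (f : Fin n → ℕ) → ∃[ σ ] SortedBy f σ
sortBy f = map₂ (λ sorted i j lt → sorted i j (inj₁ lt)) (sortingOrdering lexicographic)
  where
  lexicographic : IsStrictTotalOrder _≡_ (×-Lex _≡_ _<_ _<_ on λ v → f v , toℕ v)
  lexicographic = injective-isStrictTotalOrder (λ v → f v , toℕ v) (λ (_ , eq) → toℕ-injective eq)
                    (×-isStrictTotalOrder ℕ.<-isStrictTotalOrder ℕ.<-isStrictTotalOrder)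

module _ {n} (T : Tournament n) where

  arc? : ∀ u v → Dec (Arc T u v)
  arc? u v with u ≟ v
  ... | yes refl = no (irrefl T u)
  ... | no u≢v with total T u v u≢v
  ...   | inj₁ uv = yes uv
  ...   | inj₂ vu = no (asym T v u vu)

  transitive-or-cyclic : ∀ {y a b} → Arc T y a → Arc T a b → Arc T y b ⊎ Arc T b y
  transitive-or-cyclic {y} {a} {b} ya ab = total T y b λ { refl → asym T y a ya ab }

module _ {n} {T : Tournament n} (t : Triangle T) where

  arcOf? : ∀ u v → Dec (ArcOf t u v)
  arcOf? u v = (u ≟ a t ×-dec v ≟ b t) ⊎-dec (u ≟ b t ×-dec v ≟ c t) ⊎-dec (u ≟ c t ×-dec v ≟ a t)

  vertOf? : ∀ x → Dec (VertOf t x)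
  vertOf? x = x ≟ a t ⊎-dec x ≟ b t ⊎-dec x ≟ c t

  arcOf-source : ∀ {u v} → ArcOf t u v → VertOf t u
  arcOf-source (inj₁ (u≡a , _))        = inj₁ u≡a
  arcOf-source (inj₂ (inj₁ (u≡b , _))) = inj₂ (inj₁ u≡b)
  arcOf-source (inj₂ (inj₂ (u≡c , _))) = inj₂ (inj₂ u≡c)

  arcOf-target : ∀ {u v} → ArcOf t u v → VertOf t v
  arcOf-target (inj₁ (_ , v≡b))        = inj₂ (inj₁ v≡b)
  arcOf-target (inj₂ (inj₁ (_ , v≡c))) = inj₂ (inj₂ v≡c)
  arcOf-target (inj₂ (inj₂ (_ , v≡a))) = inj₁ v≡a

module _ {n} {T : Tournament n} {S : VSet n} (C : ConflictPacking T S) where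

  AC? : ∀ u v → Dec (AC C u v)
  AC? u v = any? λ i → arcOf? (tri-at C i) u v

  VC? : ∀ x → Dec (VC C x)
  VC? x = any? λ i → vertOf? (tri-at C i) x

  AC-source : ∀ {u v} → AC C u v → VC C u
  AC-source (i , uv) = i , arcOf-source (tri-at C i) uv

  AC-target : ∀ {u v} → AC C u v → VC C v
  AC-target (i , uv) = i , arcOf-target (tri-at C i) uv

  Guarded : Pred (Fin n) 0ℓ
  Guarded x = ¬ VC C x × (∀ y z → Arc T x y → Arc T y z → Arc T z x → AC C y z)

  guarded? : Decidable Guarded
  guarded? x = ¬? (VC? x) ×-dec
    all? λ y → all? λ z → arc? T x y →-dec arc? T y z →-dec arc? T z x →-dec AC? y z

  S₁⊆Guarded : (λ x → S x × ¬ VC C x) ⊆ Guarded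
  S₁⊆Guarded {x} (x∈S , x∉VC) = x∉VC , opposite-arc
    where
    opposite-arc : ∀ y z → Arc T x y → Arc T y z → Arc T z x → AC C y z
    opposite-arc y z xy yz zx with maximal C (tri x y z xy yz zx) (x , inj₁ refl , x∈S)
    ... | i , _ , _ , uv , inj₁ (refl , refl)        = contradiction (AC-source (i , uv)) x∉VC
    ... | i , _ , _ , uv , inj₂ (inj₁ (refl , refl)) = i , uv
    ... | i , _ , _ , uv , inj₂ (inj₂ (refl , refl)) = contradiction (AC-target (i , uv)) x∉VC

  guarded-alone : ∀ {x y z} → Guarded x → Arc T x y → Arc T y z → Arc T z x → ¬ Guarded y × ¬ Guarded z
  guarded-alone {x} {y} {z} (_ , opposite-arc) xy yz zx =
    (λ gy → proj₁ gy (AC-source yz∈AC)) , (λ gz → proj₁ gz (AC-target yz∈AC))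
    where
    yz∈AC : AC C y z
    yz∈AC = opposite-arc y z xy yz zx

  guarded-shortcut : ∀ {y a b} → Guarded y → Guarded a ⊎ Guarded b → Arc T y a → Arc T a b → Arc T y b
  guarded-shortcut gy ga⊎gb ya ab with transitive-or-cyclic T ya ab | ga⊎gb
  ... | inj₁ yb | _      = yb
  ... | inj₂ by | inj₁ ga = contradiction gy (proj₂ (guarded-alone ga ab by ya))
  ... | inj₂ by | inj₂ gb = contradiction gy (proj₁ (guarded-alone gb by ya ab))

  guardedIn? : ∀ v → Decidable λ x → Guarded x × Arc T x v
  guardedIn? v x = guarded? x ×-dec arc? T x v

  guardedClosedIn? : ∀ v → Decidable λ x → Guarded x × (Arc T x v ⊎ x ≡ v)
  guardedClosedIn? v x = guarded? x ×-dec (arc? T x v ⊎-dec x ≟ v)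

  weight : Fin n → ℕ
  weight v = count (guardedIn? v) + count (guardedClosedIn? v)

  weight-increases-out-of-guarded : ∀ {x v} → Guarded x → Arc T x v → weight x < weight v
  weight-increases-out-of-guarded {x} {v} gx xv =
    ℕ.+-mono-<-≤ (count-strict (guardedIn? x) (guardedIn? v) in⊆in (λ (_ , xx) → irrefl T x xx) (gx , xv))
                 (count-mono (guardedClosedIn? x) (guardedClosedIn? v) closed⊆closed)
    where
    in⊆in : ∀ {y} → Guarded y × Arc T y x → Guarded y × Arc T y v
    in⊆in (gy , yx) = gy , guarded-shortcut gy (inj₁ gx) yx xv

    closed⊆closed : ∀ {y} → Guarded y × (Arc T y x ⊎ y ≡ x) → Guarded y × (Arc T y v ⊎ y ≡ v)
    closed⊆closed (gy , inj₁ yx)   = gy , inj₁ (guarded-shortcut gy (inj₁ gx) yx xv)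
    closed⊆closed (gy , inj₂ refl) = gy , inj₁ xv

  weight-increases-into-guarded : ∀ {x v} → Guarded x → Arc T v x → weight v < weight x
  weight-increases-into-guarded {x} {v} gx vx =
    ℕ.+-mono-≤-< (count-mono (guardedIn? v) (guardedIn? x) in⊆in)
                 (count-strict (guardedClosedIn? v) (guardedClosedIn? x) closed⊆closed x∉closed (gx , inj₂ refl))
    where
    in⊆in : ∀ {y} → Guarded y × Arc T y v → Guarded y × Arc T y x
    in⊆in (gy , yv) = gy , guarded-shortcut gy (inj₂ gx) yv vx

    closed⊆closed : ∀ {y} → Guarded y × (Arc T y v ⊎ y ≡ v) → Guarded y × (Arc T y x ⊎ y ≡ x)
    closed⊆closed (gy , inj₁ yv)   = gy , inj₁ (guarded-shortcut gy (inj₂ gx) yv vx)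
    closed⊆closed (gy , inj₂ refl) = gy , inj₁ vx

    x∉closed : ¬ (Guarded x × (Arc T x v ⊎ x ≡ v))
    x∉closed (_ , inj₁ xv)   = asym T v x vx xv
    x∉closed (_ , inj₂ refl) = irrefl T x vx

  weight-increases-along-guarded-arc : ∀ {u v} → Guarded u ⊎ Guarded v → Arc T u v → weight u < weight v
  weight-increases-along-guarded-arc (inj₁ gu) = weight-increases-out-of-guarded gu
  weight-increases-along-guarded-arc (inj₂ gv) = weight-increases-into-guarded gv

  module _ (σ : Ordering n) (sorted : SortedBy weight σ) where
    open Inverse σ using (to)

    guarded-arc-forward : ∀ {i j} → toℕ i < toℕ j → Guarded (to i) ⊎ Guarded (to j) → Arc T (to i) (to j)
    guarded-arc-forward {i} {j} i<j guarded with total T (to i) (to j) (ℕ.<⇒≢ i<j ∘ cong toℕ ∘ Injection.injective (↔⇒↣ σ))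
    ... | inj₁ ij = ij
    ... | inj₂ ji = contradiction (sorted j i (weight-increases-along-guarded-arc (swap guarded) ji)) (ℕ.<⇒≯ i<j)

mainTheorem7 : ∀ {n} (T : Tournament n) (S : VSet n) (C : ConflictPacking T S) →
    ∃[ σ ] (∀ u v → XBackward T σ (λ x → S x × ¬ VC C x) u v → AC C u v)
mainTheorem7 T S C = σ , backward⇒AC
  where
  σ : Ordering _
  σ = proj₁ (sortBy (weight C))
  open Inverse σ using (to)

  forward : ∀ {i j} → toℕ i < toℕ j → Guarded C (to i) ⊎ Guarded C (to j) → Arc T (to i) (to j)
  forward = guarded-arc-forward C σ (proj₂ (sortBy (weight C)))

  backward⇒AC : ∀ u v → XBackward T σ (λ x → S x × ¬ VC C x) u v → AC C u v
  backward⇒AC _ _ (i , j , refl , refl , i<j , ji , inj₁ v∈S₁) =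
    contradiction ji (asym T _ _ (forward i<j (inj₁ (S₁⊆Guarded C v∈S₁))))
  backward⇒AC _ _ (i , j , refl , refl , i<j , ji , inj₂ (inj₁ u∈S₁)) =
    contradiction ji (asym T _ _ (forward i<j (inj₂ (S₁⊆Guarded C u∈S₁))))
  backward⇒AC _ _ (i , j , refl , refl , i<j , ji , inj₂ (inj₂ (q , i<q , q<j , q∈S₁))) =
    proj₂ gq (to j) (to i) (forward q<j (inj₁ gq)) ji (forward i<q (inj₂ gq))
    where
    gq : Guarded C (to q)
    gq = S₁⊆Guarded C q∈S₁
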